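{- Let $n\ge d\ge1$ be integers and let $B(n,d)$ be the bipartite graph with vertex set $\mathcal{L}^n_d\cup\mathcal{L}^n_{d-1}$, where $\mathcal{L}^n_j=\{x\subseteq[n]:|x|=j\}$, with $x,y$ adjacent iff $x\subsetneq y$. For $A\subseteq\mathcal{L}^n_d$ let $\mathcal{B}(A)$ be the set of ordered triples $(x,y,z)$ of vertices with $xy,yz\in E(B(n,d))$ (where $x=z$ is allowed), $x\in A$ and $z\notin A$. Then \[ |\mathcal{B}(A)|\ge n|A|-d\frac{|A|^2}{\binom{n-1}{d-1}}. \] -}

module Defs where

open import Data.Nat using (ℕ; zero; suc; _∸_)
open import Data.Nat.Properties using () renaming (_≟_ to _≟ℕ_)
open import Data.Vec using ([]; _∷_)
open import Data.List using (List; [_]; map; _++_; concatMap; filter; length)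
open import Data.Product using (_×_; _,_)
open import Data.Sum using (_⊎_)
open import Data.Fin.Subset using (Subset; inside; outside; ∣_∣; _⊂_)
open import Data.Fin.Subset.Properties using (_⊂?_)
open import Relation.Nullary using (¬_)
open import Relation.Nullary.Decidable using (_×-dec_; _⊎-dec_; ¬?)
open import Relation.Unary using (Pred; Decidable)
open import Relation.Binary.PropositionalEquality using (_≡_)
open import Level using (0ℓ)

allSubsets : (n : ℕ) → List (Subset n)
allSubsets zero = [ [] ]
allSubsets (suc n) = map (outside ∷_) (allSubsets n) ++ map (inside ∷_) (allSubsets n)

-- Vertices of B(n,d): members of L^n_d ∪ L^n_{d-1}  (d ≥ 1 assumed, so d ∸ 1 = d - 1).
IsVertex : {n : ℕ} (d : ℕ) → Subset n → Set
IsVertex d x = (∣ x ∣ ≡ d) ⊎ (∣ x ∣ ≡ d ∸ 1)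

isVertex? : {n : ℕ} (d : ℕ) (x : Subset n) → Relation.Nullary.Dec (IsVertex d x)
isVertex? d x = (∣ x ∣ ≟ℕ d) ⊎-dec (∣ x ∣ ≟ℕ (d ∸ 1))

Adj : {n : ℕ} (d : ℕ) → Subset n → Subset n → Set
Adj d x y = IsVertex d x × IsVertex d y × ((x ⊂ y) ⊎ (y ⊂ x))

adj? : {n : ℕ} (d : ℕ) (x y : Subset n) → Relation.Nullary.Dec (Adj d x y)
adj? d x y = isVertex? d x ×-dec (isVertex? d y ×-dec ((x ⊂? y) ⊎-dec (y ⊂? x)))

card : {n : ℕ} {A : Pred (Subset n) 0ℓ} → Decidable A → ℕ
card {n} A? = length (filter A? (allSubsets n))

allTriples : (n : ℕ) → List (Subset n × Subset n × Subset n)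
allTriples n =
  concatMap (λ x → concatMap (λ y → map (λ z → x , y , z) (allSubsets n)) (allSubsets n)) (allSubsets n)

InB : {n : ℕ} (d : ℕ) (A : Pred (Subset n) 0ℓ) → Subset n × Subset n × Subset n → Set
InB d A (x , y , z) = Adj d x y × Adj d y z × A x × ¬ A z

inB? : {n : ℕ} (d : ℕ) {A : Pred (Subset n) 0ℓ} → Decidable A → Decidable (InB d A)
inB? d A? (x , y , z) = adj? d x y ×-dec (adj? d y z ×-dec (A? x ×-dec ¬? (A? z)))

cardB : {n : ℕ} (d : ℕ) {A : Pred (Subset n) 0ℓ} → Decidable A → ℕ
cardB {n} d A? = length (filter (inB? d A?) (allTriples n))

module Submission where

-- Write ∂ (down below) for the map sending f on the d-sets to y ↦ ∑ f x over the d-sets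
-- x ⊃ y, and 1_A for the indicator of A. Counting the triples of 𝓑(A) by their middle
-- vertex y gives |𝓑(A)| = (n - d + 1) d |A| - ‖∂ 1_A‖², so the claim is the bound
-- ‖∂ f‖² ≤ (d - 1)(n - d) ‖f‖² + n (∑ f)² / C(n,d) on level d: the constants are the top
-- eigenvector of ∂*∂ and (d - 1)(n - d) is its second eigenvalue. Centering f reduces this
-- to the case ∑ f = 0, which follows by induction on d from the commutation relation
-- ∂ ∂* - ∂* ∂ = n - 2j on level j, the adjointness ‖∂ f‖² = ⟪f , ∂* ∂ f⟫ and Cauchy–Schwarz.

open import Data.Bool using (true; false; if_then_else_)
open import Data.Empty using (⊥-elim)
open import Data.Fin.Subset using (Subset; inside; outside; ∣_∣; ⊥; _⊆_; _⊂_)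
open import Data.Fin.Subset.Properties
  using (drop-∷-⊆; drop-∷-⊂; out⊂; in⊂in; out⊂in; ⊆-refl; p⊆q⇒∣p∣≤∣q∣; p⊂q⇒∣p∣<∣q∣)
open import Data.Integer
  using (ℤ; +_; -[1+_]; +[1+_]; +0; 0ℤ; 1ℤ; _+_; _-_; _*_; -_; _≤_; _<_; +≤+; +<+; nonNegative; positive)
import Data.Integer.Properties as ℤ
open import Data.Integer.Tactic.RingSolver using (solve-∀)
open import Data.List using (List; []; _∷_; _++_; map; concatMap; filter; length; foldr)
import Data.List.Properties as List
open import Data.Nat as ℕ using (ℕ; zero; suc; s≤s; z≤n; _∸_)
import Data.Nat.Properties as ℕ
open import Data.Nat.Combinatorics using (_C_; nCk+nC[k+1]≡[n+1]C[k+1])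
open import Data.Product using (_×_; _,_)
open import Data.Sum using (_⊎_; inj₁; inj₂)
open import Data.Vec using ([]; _∷_; here)
open import Function using (_∘_; flip)
open import Level using (0ℓ)
open import Relation.Binary.PropositionalEquality
open import Relation.Nullary using (Dec; yes; no; does; ¬_)
open import Relation.Nullary.Decidable using (_×-dec_; ¬?)
open import Relation.Unary using (Pred; Decidable)

open import Defs

private variable
  m k d : ℕ

∑ : (Subset m → ℤ) → ℤ
∑ {zero}  f = f []
∑ {suc m} f = ∑ (f ∘ (outside ∷_)) + ∑ (f ∘ (inside ∷_))

∑-cong : {f g : Subset m → ℤ} → (∀ x → f x ≡ g x) → ∑ f ≡ ∑ g
∑-cong {zero}  f≗g = f≗g []
∑-cong {suc m} f≗g = cong₂ _+_ (∑-cong (f≗g ∘ (outside ∷_))) (∑-cong (f≗g ∘ (inside ∷_)))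

∑-+ : (f g : Subset m → ℤ) → ∑ (λ x → f x + g x) ≡ ∑ f + ∑ g
∑-+ {zero}  f g = refl
∑-+ {suc m} f g = trans (cong₂ _+_ (∑-+ f₀ g₀) (∑-+ f₁ g₁)) (interchange (∑ f₀) (∑ g₀) (∑ f₁) (∑ g₁))
  where
  f₀ g₀ f₁ g₁ : Subset m → ℤ
  f₀ = f ∘ (outside ∷_)
  g₀ = g ∘ (outside ∷_)
  f₁ = f ∘ (inside ∷_)
  g₁ = g ∘ (inside ∷_)
  interchange : ∀ a b c d → (a + b) + (c + d) ≡ (a + c) + (b + d)
  interchange = solve-∀

∑-* : (c : ℤ) (f : Subset m → ℤ) → ∑ (λ x → c * f x) ≡ c * ∑ f
∑-* {zero}  c f = refl
∑-* {suc m} c f = trans (cong₂ _+_ (∑-* c (f ∘ (outside ∷_))) (∑-* c (f ∘ (inside ∷_))))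
                        (sym (ℤ.*-distribˡ-+ c _ _))

∑-zero : {f : Subset m → ℤ} → (∀ x → f x ≡ 0ℤ) → ∑ f ≡ 0ℤ
∑-zero {zero}  f≗0 = f≗0 []
∑-zero {suc m} f≗0 = cong₂ _+_ (∑-zero (f≗0 ∘ (outside ∷_))) (∑-zero (f≗0 ∘ (inside ∷_)))

∑-mono-≤ : {f g : Subset m → ℤ} → (∀ x → f x ≤ g x) → ∑ f ≤ ∑ g
∑-mono-≤ {zero}  f≤g = f≤g []
∑-mono-≤ {suc m} f≤g = ℤ.+-mono-≤ (∑-mono-≤ (f≤g ∘ (outside ∷_)))
                                   (∑-mono-≤ (f≤g ∘ (inside ∷_)))

∑-comm : ∀ {m m′} (f : Subset m → Subset m′ → ℤ) →
         ∑ (λ x → ∑ (λ y → f x y)) ≡ ∑ (λ y → ∑ (λ x → f x y))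
∑-comm {zero}  f = refl
∑-comm {suc m} f =
  trans (cong₂ _+_ (∑-comm (f ∘ (outside ∷_))) (∑-comm (f ∘ (inside ∷_))))
        (sym (∑-+ (λ y → ∑ (λ x → f (outside ∷ x) y)) (λ y → ∑ (λ x → f (inside ∷ x) y))))

∑-lincomb : (a b : ℤ) (f g : Subset m → ℤ) → ∑ (λ x → a * f x - b * g x) ≡ a * ∑ f - b * ∑ g
∑-lincomb a b f g = begin
  ∑ (λ x → a * f x - b * g x)
    ≡⟨ ∑-cong (λ x → cong (λ t → a * f x + t) (ℤ.neg-distribˡ-* b (g x))) ⟩
  ∑ (λ x → a * f x + - b * g x)          ≡⟨ ∑-+ (λ x → a * f x) (λ x → - b * g x) ⟩
  ∑ (λ x → a * f x) + ∑ (λ x → - b * g x) ≡⟨ cong₂ _+_ (∑-* a f) (∑-* (- b) g) ⟩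
  a * ∑ f + - b * ∑ g                    ≡⟨ cong (λ t → a * ∑ f + t) (ℤ.neg-distribˡ-* b (∑ g)) ⟨
  a * ∑ f - b * ∑ g                      ∎
  where open ≡-Reasoning

∑-- : (f g : Subset m → ℤ) → ∑ (λ x → f x - g x) ≡ ∑ f - ∑ g
∑-- f g = begin
  ∑ (λ x → f x - g x)              ≡⟨ ∑-cong (λ x → cong₂ _-_ (ℤ.*-identityˡ (f x)) (ℤ.*-identityˡ (g x))) ⟨
  ∑ (λ x → 1ℤ * f x - 1ℤ * g x)    ≡⟨ ∑-lincomb 1ℤ 1ℤ f g ⟩
  1ℤ * ∑ f - 1ℤ * ∑ g              ≡⟨ cong₂ _-_ (ℤ.*-identityˡ (∑ f)) (ℤ.*-identityˡ (∑ g)) ⟩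
  ∑ f - ∑ g                        ∎
  where open ≡-Reasoning

⟪_,_⟫ : (Subset m → ℤ) → (Subset m → ℤ) → ℤ
⟪ f , g ⟫ = ∑ λ x → f x * g x

‖_‖² : (Subset m → ℤ) → ℤ
‖ f ‖² = ⟪ f , f ⟫

square-nonNeg : ∀ i → 0ℤ ≤ i * i
square-nonNeg (+ n)    = subst (0ℤ ≤_) (ℤ.pos-* n n) (+≤+ z≤n)
square-nonNeg -[1+ n ] = +≤+ z≤n

∑-nonNeg : {f : Subset m → ℤ} → (∀ x → 0ℤ ≤ f x) → 0ℤ ≤ ∑ f
∑-nonNeg {m} {f} f≥0 = subst (_≤ ∑ f) (∑-zero {m} {λ _ → 0ℤ} λ _ → refl) (∑-mono-≤ f≥0)

*-nonNeg : ∀ {i j} → 0ℤ ≤ i → 0ℤ ≤ j → 0ℤ ≤ i * j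
*-nonNeg {i} {j} i≥0 j≥0 = subst (_≤ i * j) (ℤ.*-zeroʳ i) (ℤ.*-monoˡ-≤-nonNeg i {{nonNegative i≥0}} j≥0)

x*x≤c*x⇒x≤c : ∀ {x c} → x * x ≤ c * x → 0ℤ ≤ x → 0ℤ ≤ c → x ≤ c
x*x≤c*x⇒x≤c {+0}       _  _ c≥0 = c≥0
x*x≤c*x⇒x≤c {+[1+ n ]} {c} x²≤cx _ _ = ℤ.*-cancelʳ-≤-pos +[1+ n ] c +[1+ n ] x²≤cx

‖‖²-nonNeg : (f : Subset m → ℤ) → 0ℤ ≤ ‖ f ‖²
‖‖²-nonNeg f = ∑-nonNeg λ x → square-nonNeg (f x)

-- By Lagrange's identity ∑∑ (u x v y - u y v x)² = 2 (‖u‖² ‖v‖² - ⟪u , v⟫²).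
cauchy-schwarz : (u v : Subset m → ℤ) → ⟪ u , v ⟫ * ⟪ u , v ⟫ ≤ ‖ u ‖² * ‖ v ‖²
cauchy-schwarz u v = ℤ.0≤i-j⇒j≤i (ℤ.*-cancelˡ-≤-pos 0ℤ (U * V - P * P) (+ 2) (begin
  + 2 * 0ℤ                                           ≡⟨⟩
  0ℤ                                     ≤⟨ ∑-nonNeg (λ x → ∑-nonNeg λ y → square-nonNeg (w x y)) ⟩
  ∑ (λ x → ∑ (λ y → w x y * w x y))      ≡⟨ ∑-cong (λ x → ∑-cong λ y → w²-split x y) ⟩
  ∑ (λ x → ∑ (λ y → h x y + h y x))      ≡⟨ ∑-cong (λ x → ∑-+ (h x) (λ y → h y x)) ⟩
  ∑ (λ x → ∑ (h x) + ∑ (λ y → h y x))    ≡⟨ ∑-+ (λ x → ∑ (h x)) (λ x → ∑ (λ y → h y x)) ⟩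
  H + ∑ (λ x → ∑ (λ y → h y x))          ≡⟨ cong (_+_ H) (∑-comm (λ y x → h y x)) ⟨
  H + H                                  ≡⟨ cong (λ t → t + t) ∑∑h ⟩
  (U * V - P * P) + (U * V - P * P)      ≡⟨ double (U * V - P * P) ⟩
  + 2 * (U * V - P * P) ∎))
  where
  open ℤ.≤-Reasoning
  U V P H : ℤ
  U = ‖ u ‖²
  V = ‖ v ‖²
  P = ⟪ u , v ⟫
  w h : Subset _ → Subset _ → ℤ
  w x y = u x * v y - u y * v x
  h x y = u x * u x * (v y * v y) - u x * v x * (u y * v y)
  H = ∑ (λ x → ∑ (h x))
  w²-split : ∀ x y → w x y * w x y ≡ h x y + h y x
  w²-split x y = expand (u x) (v x) (u y) (v y)
    where
    expand : ∀ a b c d → (a * d - c * b) * (a * d - c * b)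
                       ≡ (a * a * (d * d) - a * b * (c * d)) + (c * c * (b * b) - c * d * (a * b))
    expand = solve-∀
  double : ∀ t → t + t ≡ + 2 * t
  double = solve-∀
  ∑∑h : H ≡ U * V - P * P
  ∑∑h = begin-equality
    ∑ (λ x → ∑ (h x))
      ≡⟨ ∑-cong (λ x → ∑-lincomb (u x * u x) (u x * v x) (λ y → v y * v y) (λ y → u y * v y)) ⟩
    ∑ (λ x → u x * u x * V - u x * v x * P)
      ≡⟨ ∑-cong (λ x → swap (u x * u x) V (u x * v x) P) ⟩
    ∑ (λ x → V * (u x * u x) - P * (u x * v x))
      ≡⟨ ∑-lincomb V P (λ x → u x * u x) (λ x → u x * v x) ⟩
    V * U - P * P
      ≡⟨ cong (_- P * P) (ℤ.*-comm V U) ⟩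
    U * V - P * P ∎
    where
    swap : ∀ a b c d → a * b - c * d ≡ b * a - d * c
    swap = solve-∀

‖lincomb‖² : (a b : ℤ) (u v : Subset m → ℤ) →
             ‖ (λ x → a * u x - b * v x) ‖² ≡ a * a * ‖ u ‖² - (+ 2 * a * b * ⟪ u , v ⟫ - b * b * ‖ v ‖²)
‖lincomb‖² a b u v = begin
  ∑ (λ x → (a * u x - b * v x) * (a * u x - b * v x))
    ≡⟨ ∑-cong (λ x → expand a b (u x) (v x)) ⟩
  ∑ (λ x → a * a * (u x * u x) - 1ℤ * (+ 2 * a * b * (u x * v x) - b * b * (v x * v x)))
    ≡⟨ ∑-lincomb (a * a) 1ℤ (λ x → u x * u x) (λ x → + 2 * a * b * (u x * v x) - b * b * (v x * v x)) ⟩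
  a * a * ‖ u ‖² - 1ℤ * ∑ (λ x → + 2 * a * b * (u x * v x) - b * b * (v x * v x))
    ≡⟨ cong (λ t → a * a * ‖ u ‖² - t)
            (trans (ℤ.*-identityˡ _) (∑-lincomb (+ 2 * a * b) (b * b) (λ x → u x * v x) (λ x → v x * v x))) ⟩
  a * a * ‖ u ‖² - (+ 2 * a * b * ⟪ u , v ⟫ - b * b * ‖ v ‖²) ∎
  where
  open ≡-Reasoning
  expand : ∀ a b u v → (a * u - b * v) * (a * u - b * v)
                     ≡ a * a * (u * u) - 1ℤ * (+ 2 * a * b * (u * v) - b * b * (v * v))
  expand = solve-∀

indicator : ∀ {p} {P : Set p} → Dec P → ℤ
indicator P? = if does P? then 1ℤ else 0ℤ

indicator-yes : ∀ {p} {P : Set p} (P? : Dec P) → P → indicator P? ≡ 1ℤ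
indicator-yes (yes _) _ = refl
indicator-yes (no ¬p) p = ⊥-elim (¬p p)

indicator-no : ∀ {p} {P : Set p} (P? : Dec P) → ¬ P → indicator P? ≡ 0ℤ
indicator-no (yes p) ¬p = ⊥-elim (¬p p)
indicator-no (no _)  _  = refl

indicator-× : ∀ {p q} {P : Set p} {Q : Set q} (P? : Dec P) (Q? : Dec Q) →
              indicator (P? ×-dec Q?) ≡ indicator P? * indicator Q?
indicator-× P? Q? with does P? | does Q?
... | true  | true  = refl
... | true  | false = refl
... | false | true  = refl
... | false | false = refl

indicator-¬ : ∀ {p} {P : Set p} (P? : Dec P) → indicator (¬? P?) ≡ 1ℤ - indicator P?
indicator-¬ P? with does P?
... | true  = refl
... | false = refl

0ℤ≢1ℤ : 0ℤ ≢ 1ℤ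
0ℤ≢1ℤ ()

δ : Subset m → Subset m → ℤ
δ []            []            = 1ℤ
δ (outside ∷ x) (outside ∷ y) = δ x y
δ (inside ∷ x)  (inside ∷ y)  = δ x y
δ (outside ∷ x) (inside ∷ y)  = 0ℤ
δ (inside ∷ x)  (outside ∷ y) = 0ℤ

δ-cases : (x y : Subset m) → δ x y ≡ 0ℤ ⊎ (δ x y ≡ 1ℤ × x ≡ y)
δ-cases []            []            = inj₂ (refl , refl)
δ-cases (outside ∷ x) (outside ∷ y) with δ-cases x y
... | inj₁ δ≡0          = inj₁ δ≡0
... | inj₂ (δ≡1 , refl) = inj₂ (δ≡1 , refl)
δ-cases (inside ∷ x)  (inside ∷ y)  with δ-cases x y
... | inj₁ δ≡0          = inj₁ δ≡0
... | inj₂ (δ≡1 , refl) = inj₂ (δ≡1 , refl)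
δ-cases (outside ∷ x) (inside ∷ y)  = inj₁ refl
δ-cases (inside ∷ x)  (outside ∷ y) = inj₁ refl

δ-refl : (x : Subset m) → δ x x ≡ 1ℤ
δ-refl []            = refl
δ-refl (outside ∷ x) = δ-refl x
δ-refl (inside ∷ x)  = δ-refl x

δ-sym : (x y : Subset m) → δ x y ≡ δ y x
δ-sym []            []            = refl
δ-sym (outside ∷ x) (outside ∷ y) = δ-sym x y
δ-sym (inside ∷ x)  (inside ∷ y)  = δ-sym x y
δ-sym (outside ∷ x) (inside ∷ y)  = refl
δ-sym (inside ∷ x)  (outside ∷ y) = refl

∑-0* : (f : Subset m → ℤ) → ∑ (λ x → 0ℤ * f x) ≡ 0ℤ
∑-0* f = ∑-zero (λ x → ℤ.*-zeroˡ (f x))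

∑-δ : (f : Subset m → ℤ) (y : Subset m) → ∑ (λ x → δ x y * f x) ≡ f y
∑-δ f []            = ℤ.*-identityˡ (f [])
∑-δ f (outside ∷ y) = trans (cong₂ _+_ (∑-δ (f ∘ (outside ∷_)) y) (∑-0* (f ∘ (inside ∷_))))
                            (ℤ.+-identityʳ (f (outside ∷ y)))
∑-δ f (inside ∷ y)  = trans (cong₂ _+_ (∑-0* (f ∘ (outside ∷_))) (∑-δ (f ∘ (inside ∷_)) y))
                            (ℤ.+-identityˡ (f (inside ∷ y)))

∑-δ′ : (f : Subset m → ℤ) (y : Subset m) → ∑ (λ x → δ y x * f x) ≡ f y
∑-δ′ f y = trans (∑-cong λ x → cong (_* f x) (δ-sym y x)) (∑-δ f y)

∑-δ-1 : (y : Subset m) → ∑ (λ x → δ x y) ≡ 1ℤ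
∑-δ-1 y = trans (∑-cong λ x → sym (ℤ.*-identityʳ (δ x y))) (∑-δ (λ _ → 1ℤ) y)

-- cover x y is 1 when x is y with one element added, 0 otherwise
cover : Subset m → Subset m → ℤ
cover []            []            = 0ℤ
cover (outside ∷ x) (outside ∷ y) = cover x y
cover (inside ∷ x)  (inside ∷ y)  = cover x y
cover (outside ∷ x) (inside ∷ y)  = 0ℤ
cover (inside ∷ x)  (outside ∷ y) = δ x y

cover-cases : (x y : Subset m) → cover x y ≡ 0ℤ ⊎ (cover x y ≡ 1ℤ × ∣ x ∣ ≡ suc ∣ y ∣)
cover-cases []            []            = inj₁ refl
cover-cases (outside ∷ x) (outside ∷ y) = cover-cases x y
cover-cases (inside ∷ x)  (inside ∷ y)  with cover-cases x y
... | inj₁ c≡0         = inj₁ c≡0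
... | inj₂ (c≡1 , ∣x∣≡) = inj₂ (c≡1 , cong suc ∣x∣≡)
cover-cases (outside ∷ x) (inside ∷ y)  = inj₁ refl
cover-cases (inside ∷ x)  (outside ∷ y) with δ-cases x y
... | inj₁ δ≡0          = inj₁ δ≡0
... | inj₂ (δ≡1 , refl) = inj₂ (δ≡1 , refl)

∑-cover-below : (x : Subset m) → ∑ (λ y → cover x y) ≡ + ∣ x ∣
∑-cover-below {zero}  []            = refl
∑-cover-below {suc m} (outside ∷ x) =
  trans (cong₂ _+_ (∑-cover-below x) (∑-zero {m} λ _ → refl)) (ℤ.+-identityʳ (+ ∣ x ∣))
∑-cover-below {suc m} (inside ∷ x)  =
  trans (cong₂ _+_ (∑-δ-1′ x) (∑-cover-below x)) (sym (ℤ.pos-+ 1 ∣ x ∣))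
  where
  ∑-δ-1′ : (x : Subset m) → ∑ (λ y → δ x y) ≡ 1ℤ
  ∑-δ-1′ x = trans (∑-cong (δ-sym x)) (∑-δ-1 x)

∑-cover-above : (y : Subset m) → ∑ (λ x → cover x y) ≡ + m - + ∣ y ∣
∑-cover-above {zero}  []            = refl
∑-cover-above {suc m} (outside ∷ y) =
  trans (cong₂ _+_ (∑-cover-above y) (∑-δ-1 y)) (shift (+ m) (+ ∣ y ∣))
  where
  shift : ∀ a b → a - b + 1ℤ ≡ (1ℤ + a) - b
  shift = solve-∀
∑-cover-above {suc m} (inside ∷ y)  =
  trans (cong₂ _+_ (∑-zero {m} λ _ → refl) (∑-cover-above y)) (shift (+ m) (+ ∣ y ∣))
  where
  shift : ∀ a b → 0ℤ + (a - b) ≡ (1ℤ + a) - (1ℤ + b)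
  shift = solve-∀

level : ℕ → Subset m → ℤ
level k x = indicator (∣ x ∣ ℕ.≟ k)

OnLevel : ℕ → (Subset m → ℤ) → Set
OnLevel k f = ∀ x → ∣ x ∣ ≢ k → f x ≡ 0ℤ

level-onLevel : OnLevel k (level {m} k)
level-onLevel {k} x ∣x∣≢k = indicator-no (∣ x ∣ ℕ.≟ k) ∣x∣≢k

onLevel-*ʳ : {f : Subset m → ℤ} → OnLevel k f → (g : Subset m → ℤ) → OnLevel k (λ x → f x * g x)
onLevel-*ʳ f∈k g x ∣x∣≢k = trans (cong (_* g x) (f∈k x ∣x∣≢k)) (ℤ.*-zeroˡ (g x))

onLevel-weight : {f : Subset m → ℤ} → OnLevel k f → (h : ℕ → ℤ) (x : Subset m) →
                 h ∣ x ∣ * f x ≡ h k * f x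
onLevel-weight {k = k} {f} f∈k h x with ∣ x ∣ ℕ.≟ k
... | yes refl   = refl
... | no ∣x∣≢k   = trans (cong (h ∣ x ∣ *_) fx≡0)
                   (trans (ℤ.*-zeroʳ (h ∣ x ∣)) (sym (trans (cong (h k *_) fx≡0) (ℤ.*-zeroʳ (h k)))))
  where
  fx≡0 : f x ≡ 0ℤ
  fx≡0 = f∈k x ∣x∣≢k

∑-onLevel-weight : {f : Subset m → ℤ} → OnLevel k f → (h : ℕ → ℤ) →
                   ∑ (λ x → h ∣ x ∣ * f x) ≡ h k * ∑ f
∑-onLevel-weight {k = k} {f} f∈k h = trans (∑-cong (onLevel-weight f∈k h)) (∑-* (h k) f)

⟪⟫-level : {f : Subset m → ℤ} → OnLevel k f → ⟪ f , level k ⟫ ≡ ∑ f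
⟪⟫-level {k = k} {f} f∈k = begin
  ∑ (λ x → f x * level k x)                  ≡⟨ ∑-cong (λ x → ℤ.*-comm (f x) (level k x)) ⟩
  ∑ (λ x → indicator (∣ x ∣ ℕ.≟ k) * f x)     ≡⟨ ∑-onLevel-weight f∈k (λ j → indicator (j ℕ.≟ k)) ⟩
  indicator (k ℕ.≟ k) * ∑ f                  ≡⟨ cong (_* ∑ f) (indicator-yes (k ℕ.≟ k) refl) ⟩
  1ℤ * ∑ f                                   ≡⟨ ℤ.*-identityˡ (∑ f) ⟩
  ∑ f                                        ∎
  where open ≡-Reasoning

∑-level : ∀ m k → ∑ (level {m} k) ≡ + (m C k)
∑-level zero    zero    = refl
∑-level zero    (suc k) = refl
∑-level (suc m) zero    = cong₂ _+_ (∑-level m zero) (∑-zero {m} λ _ → refl)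
∑-level (suc m) (suc k) = begin
  ∑ (level {m} (suc k)) + ∑ (level {m} k) ≡⟨ cong₂ _+_ (∑-level m (suc k)) (∑-level m k) ⟩
  + (m C suc k) + + (m C k)              ≡⟨ ℤ.pos-+ (m C suc k) (m C k) ⟨
  + (m C suc k ℕ.+ m C k)                 ≡⟨ cong +_ (ℕ.+-comm (m C suc k) (m C k)) ⟩
  + (m C k ℕ.+ m C suc k)                 ≡⟨ cong +_ (nCk+nC[k+1]≡[n+1]C[k+1] m k) ⟩
  + (suc m C suc k)                      ∎
  where open ≡-Reasoning

C-pos : ∀ {n k} → k ℕ.≤ n → 0 ℕ.< n C k
C-pos {n}     {zero}  _         = s≤s z≤n
C-pos {suc n} {suc k} (s≤s k≤n) =
  subst (0 ℕ.<_) (nCk+nC[k+1]≡[n+1]C[k+1] n k) (ℕ.<-≤-trans (C-pos k≤n) (ℕ.m≤m+n (n C k) (n C suc k)))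

‖level‖² : ∀ m k → ‖ level {m} k ‖² ≡ + (m C k)
‖level‖² m k = trans (⟪⟫-level (level-onLevel {k} {m})) (∑-level m k)

∑-onLevel-zero : {f : Subset m → ℤ} → OnLevel 0 f → ∑ f ≡ f ⊥
∑-onLevel-zero {zero}  f∈0 = refl
∑-onLevel-zero {suc m} f∈0 =
  trans (cong₂ _+_ (∑-onLevel-zero (f∈0 ∘ (outside ∷_))) (∑-zero λ x → f∈0 (inside ∷ x) λ ()))
        (ℤ.+-identityʳ _)

-- The down and up operators

apply : (Subset m → Subset m → ℤ) → (Subset m → ℤ) → Subset m → ℤ
apply K g x = ∑ λ y → K x y * g y

up down : (Subset m → ℤ) → Subset m → ℤ
up   = apply cover
down = apply (flip cover)

∑*∑ : (f g : Subset m → ℤ) → ∑ f * ∑ g ≡ ∑ (λ x → ∑ (λ y → f x * g y))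
∑*∑ f g = begin
  ∑ f * ∑ g                       ≡⟨ ℤ.*-comm (∑ f) (∑ g) ⟩
  ∑ g * ∑ f                       ≡⟨ ∑-* (∑ g) f ⟨
  ∑ (λ x → ∑ g * f x)             ≡⟨ ∑-cong (λ x → ℤ.*-comm (∑ g) (f x)) ⟩
  ∑ (λ x → f x * ∑ g)             ≡⟨ ∑-cong (λ x → ∑-* (f x) g) ⟨
  ∑ (λ x → ∑ (λ y → f x * g y))   ∎
  where open ≡-Reasoning

apply-adjoint : (K : Subset m → Subset m → ℤ) (f g : Subset m → ℤ) →
                ⟪ apply K f , g ⟫ ≡ ⟪ f , apply (flip K) g ⟫
apply-adjoint K f g = begin
  ∑ (λ x → apply K f x * g x)                    ≡⟨ ∑-cong (λ x → ℤ.*-comm (apply K f x) (g x)) ⟩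
  ∑ (λ x → g x * apply K f x)                    ≡⟨ ∑-cong (λ x → ∑-* (g x) (λ y → K x y * f y)) ⟨
  ∑ (λ x → ∑ (λ y → g x * (K x y * f y)))        ≡⟨ ∑-comm (λ x y → g x * (K x y * f y)) ⟩
  ∑ (λ y → ∑ (λ x → g x * (K x y * f y)))        ≡⟨ ∑-cong (λ y → ∑-cong λ x → rearrange (g x) (K x y) (f y)) ⟩
  ∑ (λ y → ∑ (λ x → f y * (K x y * g x)))        ≡⟨ ∑-cong (λ y → ∑-* (f y) (λ x → K x y * g x)) ⟩
  ∑ (λ y → f y * apply (flip K) g y)              ∎
  where
  open ≡-Reasoning
  rearrange : ∀ a b c → a * (b * c) ≡ c * (b * a)
  rearrange = solve-∀

apply-lincomb : (K : Subset m → Subset m → ℤ) (a b : ℤ) (f g : Subset m → ℤ) (x : Subset m) →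
                apply K (λ y → a * f y - b * g y) x ≡ a * apply K f x - b * apply K g x
apply-lincomb K a b f g x = trans (∑-cong λ y → distrib a b (K x y) (f y) (g y))
                                  (∑-lincomb a b (λ y → K x y * f y) (λ y → K x y * g y))
  where
  distrib : ∀ a b c u v → c * (a * u - b * v) ≡ a * (c * u) - b * (c * v)
  distrib = solve-∀

form : (Subset m → Subset m → ℤ) → (Subset m → ℤ) → ℤ
form K g = ∑ λ y → ∑ λ y′ → K y y′ * (g y * g y′)

gram : (Subset m → Subset m → ℤ) → Subset m → Subset m → ℤ
gram K y y′ = ∑ λ x → K x y * K x y′

‖apply‖² : (K : Subset m → Subset m → ℤ) (g : Subset m → ℤ) → ‖ apply K g ‖² ≡ form (gram K) g
‖apply‖² K g = begin
  ∑ (λ x → apply K g x * apply K g x)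
    ≡⟨ ∑-cong (λ x → ∑*∑ (λ y → K x y * g y) (λ y′ → K x y′ * g y′)) ⟩
  ∑ (λ x → ∑ (λ y → ∑ (λ y′ → K x y * g y * (K x y′ * g y′))))
    ≡⟨ ∑-comm (λ x y → ∑ (λ y′ → K x y * g y * (K x y′ * g y′))) ⟩
  ∑ (λ y → ∑ (λ x → ∑ (λ y′ → K x y * g y * (K x y′ * g y′))))
    ≡⟨ ∑-cong (λ y → ∑-comm (λ x y′ → K x y * g y * (K x y′ * g y′))) ⟩
  ∑ (λ y → ∑ (λ y′ → ∑ (λ x → K x y * g y * (K x y′ * g y′))))
    ≡⟨ ∑-cong (λ y → ∑-cong λ y′ → ∑-cong λ x → rearrange (K x y) (g y) (K x y′) (g y′)) ⟩
  ∑ (λ y → ∑ (λ y′ → ∑ (λ x → (g y * g y′) * (K x y * K x y′))))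
    ≡⟨ ∑-cong (λ y → ∑-cong λ y′ → trans (∑-* (g y * g y′) (λ x → K x y * K x y′))
                                         (ℤ.*-comm (g y * g y′) (gram K y y′))) ⟩
  form (gram K) g ∎
  where
  open ≡-Reasoning
  rearrange : ∀ a b c d → a * b * (c * d) ≡ (b * d) * (a * c)
  rearrange = solve-∀

form-+ : (K L : Subset m → Subset m → ℤ) (g : Subset m → ℤ) →
         form (λ y y′ → K y y′ + L y y′) g ≡ form K g + form L g
form-+ K L g = trans (∑-cong λ y → trans (∑-cong λ y′ → ℤ.*-distribʳ-+ (g y * g y′) (K y y′) (L y y′))
                                         (∑-+ (Kg y) (Lg y)))
                     (∑-+ (λ y → ∑ (Kg y)) (λ y → ∑ (Lg y)))
  where
  Kg Lg : Subset _ → Subset _ → ℤ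
  Kg y y′ = K y y′ * (g y * g y′)
  Lg y y′ = L y y′ * (g y * g y′)

form-diagonal : (w g : Subset m → ℤ) →
                form (λ y y′ → w y * δ y y′) g ≡ ∑ (λ y → w y * (g y * g y))
form-diagonal w g = ∑-cong λ y → begin
  ∑ (λ y′ → w y * δ y y′ * (g y * g y′))       ≡⟨ ∑-cong (λ y′ → rearrange (w y) (δ y y′) (g y) (g y′)) ⟩
  ∑ (λ y′ → w y * g y * (δ y y′ * g y′))       ≡⟨ ∑-* (w y * g y) (λ y′ → δ y y′ * g y′) ⟩
  w y * g y * ∑ (λ y′ → δ y y′ * g y′)         ≡⟨ cong (w y * g y *_) (∑-δ′ g y) ⟩
  w y * g y * g y                             ≡⟨ ℤ.*-assoc (w y) (g y) (g y) ⟩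
  w y * (g y * g y)                           ∎
  where
  open ≡-Reasoning
  rearrange : ∀ a b c d → a * b * (c * d) ≡ a * c * (b * d)
  rearrange = solve-∀

-- Off the diagonal both Gram kernels are 1 exactly when y ∪ y′ covers y (the common upper,
-- resp. y ∩ y′ the common lower neighbour); on it they are the degrees m - ∣ y ∣ and ∣ y ∣.
gram-cover-commute : (y y′ : Subset m) →
  gram cover y y′ + + ∣ y ∣ * δ y y′ ≡ gram (flip cover) y y′ + (+ m - + ∣ y ∣) * δ y y′
gram-cover-commute {zero}  []            []             = refl
gram-cover-commute {suc m} (outside ∷ y) (outside ∷ y′) = begin
  (gram cover y y′ + ∑ (λ x → δ x y * δ x y′)) + + ∣ y ∣ * δ y y′
    ≡⟨ cong (λ t → (gram cover y y′ + t) + + ∣ y ∣ * δ y y′) (∑-δ (λ x → δ x y′) y) ⟩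
  (gram cover y y′ + δ y y′) + + ∣ y ∣ * δ y y′
    ≡⟨ swap-last (gram cover y y′) (δ y y′) (+ ∣ y ∣ * δ y y′) ⟩
  (gram cover y y′ + + ∣ y ∣ * δ y y′) + δ y y′
    ≡⟨ cong (_+ δ y y′) (gram-cover-commute y y′) ⟩
  (gram (flip cover) y y′ + (+ m - + ∣ y ∣) * δ y y′) + δ y y′
    ≡⟨ absorb (gram (flip cover) y y′) (+ m) (+ ∣ y ∣) (δ y y′) ⟩
  (gram (flip cover) y y′ + 0ℤ) + (+ suc m - + ∣ y ∣) * δ y y′
    ≡⟨ cong (λ t → (gram (flip cover) y y′ + t) + (+ suc m - + ∣ y ∣) * δ y y′)
            (∑-zero {m} λ _ → refl) ⟨
  (gram (flip cover) y y′ + ∑ {m} (λ _ → 0ℤ)) + (+ suc m - + ∣ y ∣) * δ y y′ ∎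
  where
  open ≡-Reasoning
  swap-last : ∀ a b c → (a + b) + c ≡ (a + c) + b
  swap-last = solve-∀
  absorb : ∀ g M s d → (g + (M - s) * d) + d ≡ (g + 0ℤ) + ((1ℤ + M) - s) * d
  absorb = solve-∀
gram-cover-commute {suc m} (inside ∷ y)  (inside ∷ y′)  = begin
  (∑ {m} (λ _ → 0ℤ) + gram cover y y′) + + suc ∣ y ∣ * δ y y′
    ≡⟨ cong (λ t → (t + gram cover y y′) + + suc ∣ y ∣ * δ y y′) (∑-zero {m} λ _ → refl) ⟩
  (0ℤ + gram cover y y′) + + suc ∣ y ∣ * δ y y′
    ≡⟨ split-off (gram cover y y′) (+ ∣ y ∣) (δ y y′) ⟩
  (gram cover y y′ + + ∣ y ∣ * δ y y′) + δ y y′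
    ≡⟨ cong (_+ δ y y′) (gram-cover-commute y y′) ⟩
  (gram (flip cover) y y′ + (+ m - + ∣ y ∣) * δ y y′) + δ y y′
    ≡⟨ absorb (gram (flip cover) y y′) (+ m) (+ ∣ y ∣) (δ y y′) ⟩
  (δ y y′ + gram (flip cover) y y′) + (+ suc m - + suc ∣ y ∣) * δ y y′
    ≡⟨ cong (λ t → (t + gram (flip cover) y y′) + (+ suc m - + suc ∣ y ∣) * δ y y′)
            (trans (∑-δ′ (δ y′) y) (δ-sym y′ y)) ⟨
  (∑ (λ x → δ y x * δ y′ x) + gram (flip cover) y y′) + (+ suc m - + suc ∣ y ∣) * δ y y′ ∎
  where
  open ≡-Reasoning
  split-off : ∀ g s d → (0ℤ + g) + (1ℤ + s) * d ≡ (g + s * d) + d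
  split-off = solve-∀
  absorb : ∀ g M s d → (g + (M - s) * d) + d ≡ (d + g) + ((1ℤ + M) - (1ℤ + s)) * d
  absorb = solve-∀
gram-cover-commute {suc m} (outside ∷ y) (inside ∷ y′)  = begin
  (∑ (λ x → cover x y * 0ℤ) + ∑ (λ x → δ x y * cover x y′)) + + ∣ y ∣ * 0ℤ
    ≡⟨ cong₂ (λ a b → (a + b) + + ∣ y ∣ * 0ℤ)
             (∑-zero λ x → ℤ.*-zeroʳ (cover x y)) (∑-δ (λ x → cover x y′) y) ⟩
  (0ℤ + cover y y′) + + ∣ y ∣ * 0ℤ
    ≡⟨ move (cover y y′) (+ ∣ y ∣) (+ suc m - + ∣ y ∣) ⟩
  (cover y y′ + 0ℤ) + (+ suc m - + ∣ y ∣) * 0ℤ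
    ≡⟨ cong₂ (λ a b → (a + b) + (+ suc m - + ∣ y ∣) * 0ℤ)
             (trans (∑-cong λ x → ℤ.*-comm (cover y x) (δ y′ x)) (∑-δ′ (cover y) y′))
             (∑-0* (cover y′)) ⟨
  (∑ (λ x → cover y x * δ y′ x) + ∑ (λ x → 0ℤ * cover y′ x)) + (+ suc m - + ∣ y ∣) * 0ℤ ∎
  where
  open ≡-Reasoning
  move : ∀ c s t → (0ℤ + c) + s * 0ℤ ≡ (c + 0ℤ) + t * 0ℤ
  move = solve-∀
gram-cover-commute {suc m} (inside ∷ y)  (outside ∷ y′) = begin
  (∑ (λ x → 0ℤ * cover x y′) + ∑ (λ x → cover x y * δ x y′)) + + suc ∣ y ∣ * 0ℤ
    ≡⟨ cong₂ (λ a b → (a + b) + + suc ∣ y ∣ * 0ℤ)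
             (∑-0* (λ x → cover x y′))
             (trans (∑-cong λ x → ℤ.*-comm (cover x y) (δ x y′)) (∑-δ (λ x → cover x y) y′)) ⟩
  (0ℤ + cover y′ y) + + suc ∣ y ∣ * 0ℤ
    ≡⟨ move (cover y′ y) (+ suc ∣ y ∣) (+ suc m - + suc ∣ y ∣) ⟩
  (cover y′ y + 0ℤ) + (+ suc m - + suc ∣ y ∣) * 0ℤ
    ≡⟨ cong₂ (λ a b → (a + b) + (+ suc m - + suc ∣ y ∣) * 0ℤ)
             (∑-δ′ (cover y′) y)
             (∑-zero λ x → ℤ.*-zeroʳ (cover y x)) ⟨
  (∑ (λ x → δ y x * cover y′ x) + ∑ (λ x → cover y x * 0ℤ)) + (+ suc m - + suc ∣ y ∣) * 0ℤ ∎
  where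
  open ≡-Reasoning
  move : ∀ c s t → (0ℤ + c) + s * 0ℤ ≡ (c + 0ℤ) + t * 0ℤ
  move = solve-∀

‖up‖²-commute : {g : Subset m → ℤ} → OnLevel k g →
                ‖ up g ‖² + + k * ‖ g ‖² ≡ ‖ down g ‖² + (+ m - + k) * ‖ g ‖²
‖up‖²-commute {m} {k} {g} g∈k = begin
  ‖ up g ‖² + + k * ‖ g ‖²
    ≡⟨ cong₂ _+_ (‖apply‖² cover g) (sym (∑-onLevel-weight g²∈k (+_))) ⟩
  form (gram cover) g + ∑ (λ y → + ∣ y ∣ * (g y * g y))
    ≡⟨ cong (_+_ (form (gram cover) g)) (form-diagonal (λ y → + ∣ y ∣) g) ⟨
  form (gram cover) g + form (λ y y′ → + ∣ y ∣ * δ y y′) g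
    ≡⟨ form-+ (gram cover) (λ y y′ → + ∣ y ∣ * δ y y′) g ⟨
  form (λ y y′ → gram cover y y′ + + ∣ y ∣ * δ y y′) g
    ≡⟨ ∑-cong (λ y → ∑-cong λ y′ → cong (_* (g y * g y′)) (gram-cover-commute y y′)) ⟩
  form (λ y y′ → gram (flip cover) y y′ + (+ m - + ∣ y ∣) * δ y y′) g
    ≡⟨ form-+ (gram (flip cover)) (λ y y′ → (+ m - + ∣ y ∣) * δ y y′) g ⟩
  form (gram (flip cover)) g + form (λ y y′ → (+ m - + ∣ y ∣) * δ y y′) g
    ≡⟨ cong (_+_ (form (gram (flip cover)) g)) (form-diagonal (λ y → + m - + ∣ y ∣) g) ⟩
  form (gram (flip cover)) g + ∑ (λ y → (+ m - + ∣ y ∣) * (g y * g y))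
    ≡⟨ cong₂ _+_ (sym (‖apply‖² (flip cover) g)) (∑-onLevel-weight g²∈k (λ j → + m - + j)) ⟩
  ‖ down g ‖² + (+ m - + k) * ‖ g ‖² ∎
  where
  open ≡-Reasoning
  g²∈k : OnLevel k (λ y → g y * g y)
  g²∈k = onLevel-*ʳ g∈k g

cover-*-onLevel : {f : Subset m → ℤ} → OnLevel (suc k) f → (x y : Subset m) → ∣ y ∣ ≢ k →
                  cover x y * f x ≡ 0ℤ
cover-*-onLevel {f = f} f∈ x y ∣y∣≢k with cover-cases x y
... | inj₁ c≡0          = trans (cong (_* f x) c≡0) (ℤ.*-zeroˡ (f x))
... | inj₂ (_ , ∣x∣≡1+∣y∣) =
  trans (cong (cover x y *_) (f∈ x (∣y∣≢k ∘ ℕ.suc-injective ∘ trans (sym ∣x∣≡1+∣y∣))))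
        (ℤ.*-zeroʳ (cover x y))

down-onLevel : {f : Subset m → ℤ} → OnLevel (suc k) f → OnLevel k (down f)
down-onLevel f∈ y ∣y∣≢k = ∑-zero λ x → cover-*-onLevel f∈ x y ∣y∣≢k

∑-down : {f : Subset m → ℤ} → OnLevel k f → ∑ (down f) ≡ + k * ∑ f
∑-down {k = k} {f} f∈k = begin
  ∑ (λ y → ∑ (λ x → cover x y * f x))
    ≡⟨ ∑-comm (λ y x → cover x y * f x) ⟩
  ∑ (λ x → ∑ (λ y → cover x y * f x))
    ≡⟨ ∑-cong (λ x → trans (∑-cong λ y → ℤ.*-comm (cover x y) (f x)) (∑-* (f x) (cover x))) ⟩
  ∑ (λ x → f x * ∑ (cover x))
    ≡⟨ ∑-cong (λ x → trans (cong (f x *_) (∑-cover-below x)) (ℤ.*-comm (f x) (+ ∣ x ∣))) ⟩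
  ∑ (λ x → + ∣ x ∣ * f x)
    ≡⟨ ∑-onLevel-weight f∈k (+_) ⟩
  + k * ∑ f ∎
  where open ≡-Reasoning

down-level : (y : Subset m) → down (level (suc k)) y ≡ (+ m - + k) * level k y
down-level {m} {k} y = begin
  ∑ (λ x → cover x y * level (suc k) x)  ≡⟨ ∑-cong level-step ⟩
  ∑ (λ x → level k y * cover x y)        ≡⟨ ∑-* (level k y) (λ x → cover x y) ⟩
  level k y * ∑ (λ x → cover x y)        ≡⟨ cong (level k y *_) (∑-cover-above y) ⟩
  level k y * (+ m - + ∣ y ∣)            ≡⟨ ℤ.*-comm (level k y) (+ m - + ∣ y ∣) ⟩
  (+ m - + ∣ y ∣) * level k y            ≡⟨ onLevel-weight level-onLevel (λ j → + m - + j) y ⟩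
  (+ m - + k) * level k y                ∎
  where
  open ≡-Reasoning
  level-step : ∀ x → cover x y * level (suc k) x ≡ level k y * cover x y
  level-step x with cover-cases x y
  ... | inj₁ c≡0             = trans (cong (_* level (suc k) x) c≡0)
                                     (sym (trans (cong (level k y *_) c≡0) (ℤ.*-zeroʳ (level k y))))
  ... | inj₂ (_ , ∣x∣≡1+∣y∣) rewrite ∣x∣≡1+∣y∣ = ℤ.*-comm (cover x y) (level k y)

-- Double counting the pairs y ⊂ x with ∣ y ∣ = k and ∣ x ∣ = k + 1.
level-size-ratio : ∀ m k → (+ m - + k) * + (m C k) ≡ + suc k * + (m C suc k)
level-size-ratio m k = begin
  (+ m - + k) * + (m C k)               ≡⟨ cong ((+ m - + k) *_) (∑-level m k) ⟨
  (+ m - + k) * ∑ (level {m} k)         ≡⟨ ∑-* (+ m - + k) (level {m} k) ⟨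
  ∑ (λ y → (+ m - + k) * level {m} k y) ≡⟨ ∑-cong (down-level {m} {k}) ⟨
  ∑ (down (level {m} (suc k)))          ≡⟨ ∑-down (level-onLevel {suc k} {m}) ⟩
  + suc k * ∑ (level {m} (suc k))       ≡⟨ cong (+ suc k *_) (∑-level m (suc k)) ⟩
  + suc k * + (m C suc k)               ∎
  where open ≡-Reasoning

-- The spectral bound

down-bound-mean-zero : suc k ℕ.≤ m → {f : Subset m → ℤ} → OnLevel (suc k) f → ∑ f ≡ 0ℤ →
                       ‖ down f ‖² ≤ + k * (+ m - + suc k) * ‖ f ‖²
down-bound-mean-zero {zero} _ {f} f∈1 ∑f≡0 = ℤ.≤-reflexive (begin
  ‖ down f ‖²                 ≡⟨ ∑-onLevel-zero (onLevel-*ʳ (down-onLevel f∈1) (down f)) ⟩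
  down f ⊥ * down f ⊥         ≡⟨ cong (λ t → t * t) (∑-onLevel-zero (down-onLevel f∈1)) ⟨
  ∑ (down f) * ∑ (down f)     ≡⟨ cong (λ t → t * t) (trans (∑-down f∈1) (cong (+ 1 *_) ∑f≡0)) ⟩
  0ℤ                          ≡⟨ ℤ.*-zeroˡ ‖ f ‖² ⟨
  0ℤ * ‖ f ‖²                 ∎)
  where open ≡-Reasoning
down-bound-mean-zero {suc k} {m} 2+k≤m {f} f∈ ∑f≡0 = x*x≤c*x⇒x≤c G*G≤μF*G (‖‖²-nonNeg g) μF≥0
  where
  open ℤ.≤-Reasoning
  g : Subset m → ℤ
  g = down f
  G F μ : ℤ
  G = ‖ g ‖²
  F = ‖ f ‖²
  μ = + suc k * (+ m - + suc (suc k))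

  g∈ : OnLevel (suc k) g
  g∈ = down-onLevel f∈

  ∑g≡0 : ∑ g ≡ 0ℤ
  ∑g≡0 = trans (∑-down f∈) (trans (cong (+ suc (suc k) *_) ∑f≡0) (ℤ.*-zeroʳ (+ suc (suc k))))

  μF≥0 : 0ℤ ≤ μ * F
  μF≥0 = *-nonNeg (*-nonNeg (+≤+ {n = suc k} z≤n) (ℤ.i≤j⇒0≤j-i (+≤+ 2+k≤m))) (‖‖²-nonNeg f)

  ‖up‖²≤μG : ‖ up g ‖² ≤ μ * G
  ‖up‖²≤μG = begin
    ‖ up g ‖²                                              ≡⟨ cancel-+ ‖ up g ‖² (+ suc k * G) ⟩
    (‖ up g ‖² + + suc k * G) - + suc k * G                ≡⟨ cong (_- + suc k * G) (‖up‖²-commute g∈) ⟩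
    (‖ down g ‖² + (+ m - + suc k) * G) - + suc k * G
      ≤⟨ ℤ.+-monoˡ-≤ (- (+ suc k * G)) (ℤ.+-monoˡ-≤ ((+ m - + suc k) * G)
                                        (down-bound-mean-zero (ℕ.<⇒≤ 2+k≤m) g∈ ∑g≡0)) ⟩
    (+ k * (+ m - + suc k) * G + (+ m - + suc k) * G) - + suc k * G
      ≡⟨ collect (+ k) (+ m) G ⟩
    μ * G                                                  ∎
    where
    cancel-+ : ∀ a b → a ≡ (a + b) - b
    cancel-+ = solve-∀
    collect : ∀ k m G → (k * (m - (1ℤ + k)) * G + (m - (1ℤ + k)) * G) - (1ℤ + k) * G
                      ≡ (1ℤ + k) * (m - (1ℤ + (1ℤ + k))) * G
    collect = solve-∀

  G*G≤μF*G : G * G ≤ μ * F * G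
  G*G≤μF*G = begin
    G * G                              ≡⟨ cong (λ t → t * t) (apply-adjoint (flip cover) f g) ⟩
    ⟪ f , up g ⟫ * ⟪ f , up g ⟫        ≤⟨ cauchy-schwarz f (up g) ⟩
    F * ‖ up g ‖²                      ≤⟨ ℤ.*-monoˡ-≤-nonNeg F {{nonNegative (‖‖²-nonNeg f)}} ‖up‖²≤μG ⟩
    F * (μ * G)                        ≡⟨ rearrange F μ G ⟩
    μ * F * G                          ∎
    where
    rearrange : ∀ a b c → a * (b * c) ≡ b * a * c
    rearrange = solve-∀

-- The algebra of down-bound, which applies down-bound-mean-zero to N f - (∑ f) 1 on level k + 1.
centering-arithmetic : ∀ (k m N G F S : ℤ) →
  N * N * G - (+ 2 * N * (S * (m - k)) * ((1ℤ + k) * S) - S * (m - k) * S * ((1ℤ + k) * N))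
    ≤ k * (m - (1ℤ + k)) * (N * N * F - (+ 2 * N * S * S - S * S * N)) →
  N * (N * G) ≤ N * (k * (m - (1ℤ + k)) * N * F + m * (S * S))
centering-arithmetic k m N G F S bound = begin
  N * (N * G)
    ≡⟨ split-off k m N G S ⟩
  N * N * G - (+ 2 * N * (S * (m - k)) * ((1ℤ + k) * S) - S * (m - k) * S * ((1ℤ + k) * N))
    + N * S * S * ((m - k) * (1ℤ + k))
    ≤⟨ ℤ.+-monoˡ-≤ (N * S * S * ((m - k) * (1ℤ + k))) bound ⟩
  k * (m - (1ℤ + k)) * (N * N * F - (+ 2 * N * S * S - S * S * N)) + N * S * S * ((m - k) * (1ℤ + k))
    ≡⟨ collect k m N F S ⟩
  N * (k * (m - (1ℤ + k)) * N * F + m * (S * S)) ∎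
  where
  open ℤ.≤-Reasoning
  split-off : ∀ k m N G S → N * (N * G)
    ≡ N * N * G - (+ 2 * N * (S * (m - k)) * ((1ℤ + k) * S) - S * (m - k) * S * ((1ℤ + k) * N))
      + N * S * S * ((m - k) * (1ℤ + k))
  split-off = solve-∀
  collect : ∀ k m N F S →
    k * (m - (1ℤ + k)) * (N * N * F - (+ 2 * N * S * S - S * S * N)) + N * S * S * ((m - k) * (1ℤ + k))
    ≡ N * (k * (m - (1ℤ + k)) * N * F + m * (S * S))
  collect = solve-∀

down-bound : suc k ℕ.≤ m → {f : Subset m → ℤ} → OnLevel (suc k) f →
             + (m C suc k) * ‖ down f ‖²
               ≤ + k * (+ m - + suc k) * + (m C suc k) * ‖ f ‖² + + m * (∑ f * ∑ f)
down-bound {k} {m} 1+k≤m {f} f∈ =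
  ℤ.*-cancelˡ-≤-pos _ _ N {{positive (+<+ (C-pos 1+k≤m))}}
    (centering-arithmetic (+ k) (+ m) N ‖ down f ‖² ‖ f ‖² S
      (subst₂ _≤_ ‖down-f′‖² (cong (+ k * (+ m - + suc k) *_) ‖f′‖²)
              (down-bound-mean-zero 1+k≤m f′∈ ∑f′≡0)))
  where
  N S c : ℤ
  N = + (m C suc k)
  S = ∑ f
  c = S * (+ m - + k)

  f′ : Subset m → ℤ
  f′ x = N * f x - S * level (suc k) x

  f′∈ : OnLevel (suc k) f′
  f′∈ x ∣x∣≢1+k =
    trans (cong₂ (λ a b → N * a - S * b) (f∈ x ∣x∣≢1+k) (level-onLevel x ∣x∣≢1+k)) (vanish N S)
    where
    vanish : ∀ a b → a * 0ℤ - b * 0ℤ ≡ 0ℤ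
    vanish = solve-∀

  ∑f′≡0 : ∑ f′ ≡ 0ℤ
  ∑f′≡0 = trans (∑-lincomb N S f (level (suc k)))
                (trans (cong (λ t → N * S - S * t) (∑-level m (suc k))) (cancel N S))
    where
    cancel : ∀ a b → a * b - b * a ≡ 0ℤ
    cancel = solve-∀

  ‖f′‖² : ‖ f′ ‖² ≡ N * N * ‖ f ‖² - (+ 2 * N * S * S - S * S * N)
  ‖f′‖² = trans (‖lincomb‖² N S f (level (suc k)))
                (cong₂ (λ a b → N * N * ‖ f ‖² - (+ 2 * N * S * a - S * S * b))
                       (⟪⟫-level f∈) (‖level‖² m (suc k)))

  down-f′ : ∀ y → down f′ y ≡ N * down f y - c * level k y
  down-f′ y = trans (apply-lincomb (flip cover) N S f (level (suc k)) y)
                    (cong (λ t → N * down f y - t)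
                          (trans (cong (S *_) (down-level y)) (sym (ℤ.*-assoc S (+ m - + k) (level k y)))))

  ‖down-f′‖² : ‖ down f′ ‖²
             ≡ N * N * ‖ down f ‖² - (+ 2 * N * c * (+ suc k * S) - c * S * (+ suc k * N))
  ‖down-f′‖² = begin
    ‖ down f′ ‖²
      ≡⟨ ∑-cong (λ y → cong₂ _*_ (down-f′ y) (down-f′ y)) ⟩
    ‖ (λ y → N * down f y - c * level k y) ‖²
      ≡⟨ ‖lincomb‖² N c (down f) (level k) ⟩
    N * N * ‖ down f ‖² - (+ 2 * N * c * ⟪ down f , level k ⟫ - c * c * ‖ level {m} k ‖²)
      ≡⟨ cong₂ (λ a b → N * N * ‖ down f ‖² - (+ 2 * N * c * a - c * c * b))
               (trans (⟪⟫-level (down-onLevel f∈)) (∑-down f∈))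
               (‖level‖² m k) ⟩
    N * N * ‖ down f ‖² - (+ 2 * N * c * (+ suc k * S) - c * c * + (m C k))
      ≡⟨ cong (λ t → N * N * ‖ down f ‖² - (+ 2 * N * c * (+ suc k * S) - t))
              (trans (reassoc c S (+ m - + k) (+ (m C k))) (cong (c * S *_) (level-size-ratio m k))) ⟩
    N * N * ‖ down f ‖² - (+ 2 * N * c * (+ suc k * S) - c * S * (+ suc k * N)) ∎
    where
    open ≡-Reasoning
    reassoc : ∀ c s d n → c * (s * d) * n ≡ c * s * (d * n)
    reassoc = solve-∀

-- Counting 𝓑(A)

sumℤ : List ℤ → ℤ
sumℤ = foldr _+_ 0ℤ

sumℤ-++ : (xs ys : List ℤ) → sumℤ (xs ++ ys) ≡ sumℤ xs + sumℤ ys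
sumℤ-++ []       ys = sym (ℤ.+-identityˡ (sumℤ ys))
sumℤ-++ (x ∷ xs) ys = trans (cong (_+_ x) (sumℤ-++ xs ys)) (sym (ℤ.+-assoc x (sumℤ xs) (sumℤ ys)))

length-filter : ∀ {a p} {A : Set a} {P : Pred A p} (P? : Decidable P) (xs : List A) →
                + length (filter P? xs) ≡ sumℤ (map (indicator ∘ P?) xs)
length-filter P? []       = refl
length-filter P? (x ∷ xs) with does (P? x)
... | true  = cong (_+_ 1ℤ) (length-filter P? xs)
... | false = trans (length-filter P? xs) (sym (ℤ.+-identityˡ _))

sumℤ-concatMap : ∀ {a b} {A : Set a} {B : Set b} (g : B → ℤ) (h : A → List B) (xs : List A) →
                 sumℤ (map g (concatMap h xs)) ≡ sumℤ (map (λ x → sumℤ (map g (h x))) xs)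
sumℤ-concatMap g h []       = refl
sumℤ-concatMap g h (x ∷ xs) = begin
  sumℤ (map g (h x ++ concatMap h xs))                ≡⟨ cong sumℤ (List.map-++ g (h x) (concatMap h xs)) ⟩
  sumℤ (map g (h x) ++ map g (concatMap h xs))        ≡⟨ sumℤ-++ (map g (h x)) (map g (concatMap h xs)) ⟩
  sumℤ (map g (h x)) + sumℤ (map g (concatMap h xs))
    ≡⟨ cong (_+_ (sumℤ (map g (h x)))) (sumℤ-concatMap g h xs) ⟩
  sumℤ (map (λ x → sumℤ (map g (h x))) (x ∷ xs))      ∎
  where open ≡-Reasoning

sumℤ-allSubsets : (f : Subset m → ℤ) → sumℤ (map f (allSubsets m)) ≡ ∑ f
sumℤ-allSubsets {zero}  f = ℤ.+-identityʳ (f [])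
sumℤ-allSubsets {suc m} f = begin
  sumℤ (map f (map (outside ∷_) (allSubsets m) ++ map (inside ∷_) (allSubsets m)))
    ≡⟨ cong sumℤ (List.map-++ f (map (outside ∷_) (allSubsets m)) (map (inside ∷_) (allSubsets m))) ⟩
  sumℤ (map f (map (outside ∷_) (allSubsets m)) ++ map f (map (inside ∷_) (allSubsets m)))
    ≡⟨ sumℤ-++ (map f (map (outside ∷_) (allSubsets m))) (map f (map (inside ∷_) (allSubsets m))) ⟩
  sumℤ (map f (map (outside ∷_) (allSubsets m))) + sumℤ (map f (map (inside ∷_) (allSubsets m)))
    ≡⟨ cong₂ (λ xs ys → sumℤ xs + sumℤ ys) (List.map-∘ (allSubsets m)) (List.map-∘ (allSubsets m)) ⟨
  sumℤ (map (f ∘ (outside ∷_)) (allSubsets m)) + sumℤ (map (f ∘ (inside ∷_)) (allSubsets m))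
    ≡⟨ cong₂ _+_ (sumℤ-allSubsets (f ∘ (outside ∷_))) (sumℤ-allSubsets (f ∘ (inside ∷_))) ⟩
  ∑ f ∎
  where open ≡-Reasoning

sumℤ-concatMap-allSubsets : ∀ {b} {B : Set b} (F : B → ℤ) (h : Subset m → List B) →
                            sumℤ (map F (concatMap h (allSubsets m))) ≡ ∑ λ x → sumℤ (map F (h x))
sumℤ-concatMap-allSubsets {m} F h =
  trans (sumℤ-concatMap F h (allSubsets m)) (sumℤ-allSubsets (λ x → sumℤ (map F (h x))))

sumℤ-allTriples : ∀ n (F : Subset n × Subset n × Subset n → ℤ) →
                  sumℤ (map F (allTriples n)) ≡ ∑ λ x → ∑ λ y → ∑ λ z → F (x , y , z)
sumℤ-allTriples n F =
  trans (sumℤ-concatMap-allSubsets F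
           (λ x → concatMap (λ y → map (λ z → x , y , z) (allSubsets n)) (allSubsets n)))
        (∑-cong λ x → trans (sumℤ-concatMap-allSubsets F (λ y → map (λ z → x , y , z) (allSubsets n)))
        (∑-cong λ y → trans (cong sumℤ (sym (List.map-∘ {g = F} {f = λ z → x , y , z} (allSubsets n))))
                            (sumℤ-allSubsets (λ z → F (x , y , z)))))

⊆∧∣∣≡⇒≡ : {p q : Subset m} → p ⊆ q → ∣ p ∣ ≡ ∣ q ∣ → p ≡ q
⊆∧∣∣≡⇒≡ {p = []}          {[]}          _   _ = refl
⊆∧∣∣≡⇒≡ {p = outside ∷ p} {outside ∷ q} p⊆q h = cong (outside ∷_) (⊆∧∣∣≡⇒≡ (drop-∷-⊆ p⊆q) h)
⊆∧∣∣≡⇒≡ {p = inside ∷ p}  {inside ∷ q}  p⊆q h =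
  cong (inside ∷_) (⊆∧∣∣≡⇒≡ (drop-∷-⊆ p⊆q) (ℕ.suc-injective h))
⊆∧∣∣≡⇒≡ {p = outside ∷ p} {inside ∷ q}  p⊆q h =
  ⊥-elim (ℕ.<-irrefl h (s≤s (p⊆q⇒∣p∣≤∣q∣ (drop-∷-⊆ p⊆q))))
⊆∧∣∣≡⇒≡ {p = inside ∷ p}  {outside ∷ q} p⊆q h with p⊆q here
... | ()

cover≡1⇒∣∣ : (x y : Subset m) → cover x y ≡ 1ℤ → ∣ x ∣ ≡ suc ∣ y ∣
cover≡1⇒∣∣ x y c≡1 with cover-cases x y
... | inj₁ c≡0         = ⊥-elim (0ℤ≢1ℤ (trans (sym c≡0) c≡1))
... | inj₂ (_ , ∣x∣≡) = ∣x∣≡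

cover≡1⇒⊂ : (x y : Subset m) → cover x y ≡ 1ℤ → y ⊂ x
cover≡1⇒⊂ []            []            ()
cover≡1⇒⊂ (outside ∷ x) (outside ∷ y) c≡1 = out⊂ (cover≡1⇒⊂ x y c≡1)
cover≡1⇒⊂ (inside ∷ x)  (inside ∷ y)  c≡1 = in⊂in (cover≡1⇒⊂ x y c≡1)
cover≡1⇒⊂ (inside ∷ x)  (outside ∷ y) c≡1 with δ-cases x y
... | inj₂ (_ , refl) = out⊂in ⊆-refl
... | inj₁ δ≡0        = ⊥-elim (0ℤ≢1ℤ (trans (sym δ≡0) c≡1))
cover≡1⇒⊂ (outside ∷ x) (inside ∷ y)  ()

⊂⇒cover≡1 : (x y : Subset m) → y ⊂ x → ∣ x ∣ ≡ suc ∣ y ∣ → cover x y ≡ 1ℤ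
⊂⇒cover≡1 []            []            _   ()
⊂⇒cover≡1 (outside ∷ x) (outside ∷ y) y⊂x h = ⊂⇒cover≡1 x y (drop-∷-⊂ y⊂x) h
⊂⇒cover≡1 (inside ∷ x)  (inside ∷ y)  y⊂x h = ⊂⇒cover≡1 x y (drop-∷-⊂ y⊂x) (ℕ.suc-injective h)
⊂⇒cover≡1 (inside ∷ x)  (outside ∷ y) (y⊆x , _) h
  rewrite ⊆∧∣∣≡⇒≡ (drop-∷-⊆ y⊆x) (sym (ℕ.suc-injective h)) = δ-refl x
⊂⇒cover≡1 (outside ∷ x) (inside ∷ y)  (y⊆x , _) h with y⊆x here
... | ()

indicator-cover : ∀ {p} {P : Set p} (P? : Dec P) (x y : Subset m) →
                  (P → cover x y ≡ 1ℤ) → (cover x y ≡ 1ℤ → P) → indicator P? ≡ cover x y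
indicator-cover P? x y P⇒c≡1 c≡1⇒P with cover-cases x y
... | inj₁ c≡0       = trans (indicator-no P? λ p → 0ℤ≢1ℤ (trans (sym c≡0) (P⇒c≡1 p))) (sym c≡0)
... | inj₂ (c≡1 , _) = trans (indicator-yes P? (c≡1⇒P c≡1)) (sym c≡1)

indicator-adj-below : (x y : Subset m) → ∣ x ∣ ≡ suc d → indicator (adj? (suc d) x y) ≡ cover x y
indicator-adj-below {d = d} x y ∣x∣≡1+d = indicator-cover (adj? (suc d) x y) x y to from
  where
  to : Adj (suc d) x y → cover x y ≡ 1ℤ
  to (_ , inj₁ ∣y∣≡1+d , inj₁ x⊂y) = ⊥-elim (ℕ.<-irrefl (trans ∣x∣≡1+d (sym ∣y∣≡1+d)) (p⊂q⇒∣p∣<∣q∣ x⊂y))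
  to (_ , inj₂ ∣y∣≡d   , inj₁ x⊂y) =
    ⊥-elim (ℕ.<-asym (subst₂ ℕ._<_ (sym ∣y∣≡d) (sym ∣x∣≡1+d) (ℕ.n<1+n d)) (p⊂q⇒∣p∣<∣q∣ x⊂y))
  to (_ , inj₁ ∣y∣≡1+d , inj₂ y⊂x) = ⊥-elim (ℕ.<-irrefl (trans ∣y∣≡1+d (sym ∣x∣≡1+d)) (p⊂q⇒∣p∣<∣q∣ y⊂x))
  to (_ , inj₂ ∣y∣≡d   , inj₂ y⊂x) = ⊂⇒cover≡1 x y y⊂x (trans ∣x∣≡1+d (cong suc (sym ∣y∣≡d)))
  from : cover x y ≡ 1ℤ → Adj (suc d) x y
  from c≡1 = inj₁ ∣x∣≡1+d
           , inj₂ (ℕ.suc-injective (trans (sym (cover≡1⇒∣∣ x y c≡1)) ∣x∣≡1+d))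
           , inj₂ (cover≡1⇒⊂ x y c≡1)

indicator-adj-above : (y z : Subset m) → ∣ y ∣ ≡ d → indicator (adj? (suc d) y z) ≡ cover z y
indicator-adj-above {d = d} y z ∣y∣≡d = indicator-cover (adj? (suc d) y z) z y to from
  where
  to : Adj (suc d) y z → cover z y ≡ 1ℤ
  to (_ , inj₁ ∣z∣≡1+d , inj₁ y⊂z) = ⊂⇒cover≡1 z y y⊂z (trans ∣z∣≡1+d (cong suc (sym ∣y∣≡d)))
  to (_ , inj₂ ∣z∣≡d   , inj₁ y⊂z) = ⊥-elim (ℕ.<-irrefl (trans ∣y∣≡d (sym ∣z∣≡d)) (p⊂q⇒∣p∣<∣q∣ y⊂z))
  to (_ , inj₁ ∣z∣≡1+d , inj₂ z⊂y) =
    ⊥-elim (ℕ.<-asym (subst₂ ℕ._<_ (sym ∣y∣≡d) (sym ∣z∣≡1+d) (ℕ.n<1+n d)) (p⊂q⇒∣p∣<∣q∣ z⊂y))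
  to (_ , inj₂ ∣z∣≡d   , inj₂ z⊂y) = ⊥-elim (ℕ.<-irrefl (trans ∣z∣≡d (sym ∣y∣≡d)) (p⊂q⇒∣p∣<∣q∣ z⊂y))
  from : cover z y ≡ 1ℤ → Adj (suc d) y z
  from c≡1 = inj₂ ∣y∣≡d
           , inj₁ (trans (cover≡1⇒∣∣ z y c≡1) (cong suc ∣y∣≡d))
           , inj₁ (cover≡1⇒⊂ z y c≡1)

module LevelSet {n d : ℕ} {A : Pred (Subset n) 0ℓ} (A? : Decidable A)
                (A⊆level : ∀ x → A x → ∣ x ∣ ≡ suc d) where

  𝟙A : Subset n → ℤ
  𝟙A x = indicator (A? x)

  𝟙A-onLevel : OnLevel (suc d) 𝟙A
  𝟙A-onLevel x ∣x∣≢1+d = indicator-no (A? x) (∣x∣≢1+d ∘ A⊆level x)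

  ‖𝟙A‖² : ‖ 𝟙A ‖² ≡ ∑ 𝟙A
  ‖𝟙A‖² = ∑-cong idempotent
    where
    idempotent : ∀ x → 𝟙A x * 𝟙A x ≡ 𝟙A x
    idempotent x with does (A? x)
    ... | true  = refl
    ... | false = refl

  card≡∑𝟙A : + card A? ≡ ∑ 𝟙A
  card≡∑𝟙A = trans (length-filter A? (allSubsets n)) (sumℤ-allSubsets 𝟙A)

  𝟙A*adj-below : ∀ x y → 𝟙A x * indicator (adj? (suc d) x y) ≡ 𝟙A x * cover x y
  𝟙A*adj-below x y with A? x
  ... | yes x∈A = cong (1ℤ *_) (indicator-adj-below x y (A⊆level x x∈A))
  ... | no  _   = trans (ℤ.*-zeroˡ (indicator (adj? (suc d) x y))) (sym (ℤ.*-zeroˡ (cover x y)))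

  𝟙A*cover*adj-above : ∀ x y z →
                       𝟙A x * cover x y * indicator (adj? (suc d) y z) ≡ 𝟙A x * cover x y * cover z y
  𝟙A*cover*adj-above x y z with A? x | cover-cases x y
  ... | no _    | _                  = trans (*-zero-* (cover x y) (indicator (adj? (suc d) y z)))
                                             (sym (*-zero-* (cover x y) (cover z y)))
    where
    *-zero-* : ∀ a b → 0ℤ * a * b ≡ 0ℤ
    *-zero-* = solve-∀
  ... | yes _   | inj₁ c≡0           = trans (cong (λ c → 1ℤ * c * indicator (adj? (suc d) y z)) c≡0)
                                             (sym (cong (λ c → 1ℤ * c * cover z y) c≡0))
  ... | yes x∈A | inj₂ (_ , ∣x∣≡1+∣y∣) =
    cong (1ℤ * cover x y *_)
         (indicator-adj-above y z (ℕ.suc-injective (trans (sym ∣x∣≡1+∣y∣) (A⊆level x x∈A))))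

  indicator-inB : ∀ x y z →
                  indicator (inB? (suc d) A? (x , y , z)) ≡ 𝟙A x * cover x y * (cover z y * (1ℤ - 𝟙A z))
  indicator-inB x y z = begin
    indicator (inB? (suc d) A? (x , y , z))
      ≡⟨ trans (indicator-× (adj? (suc d) x y) (adj? (suc d) y z ×-dec (A? x ×-dec ¬? (A? z))))
         (cong (I₁ *_) (trans (indicator-× (adj? (suc d) y z) (A? x ×-dec ¬? (A? z)))
         (cong (I₂ *_) (trans (indicator-× (A? x) (¬? (A? z))) (cong (𝟙A x *_) (indicator-¬ (A? z))))))) ⟩
    I₁ * (I₂ * (𝟙A x * (1ℤ - 𝟙A z)))     ≡⟨ reassoc I₁ I₂ (𝟙A x) (1ℤ - 𝟙A z) ⟩
    𝟙A x * I₁ * I₂ * (1ℤ - 𝟙A z)         ≡⟨ cong (λ t → t * I₂ * (1ℤ - 𝟙A z)) (𝟙A*adj-below x y) ⟩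
    𝟙A x * cover x y * I₂ * (1ℤ - 𝟙A z)  ≡⟨ cong (_* (1ℤ - 𝟙A z)) (𝟙A*cover*adj-above x y z) ⟩
    𝟙A x * cover x y * cover z y * (1ℤ - 𝟙A z)  ≡⟨ ℤ.*-assoc (𝟙A x * cover x y) (cover z y) (1ℤ - 𝟙A z) ⟩
    𝟙A x * cover x y * (cover z y * (1ℤ - 𝟙A z)) ∎
    where
    open ≡-Reasoning
    I₁ I₂ : ℤ
    I₁ = indicator (adj? (suc d) x y)
    I₂ = indicator (adj? (suc d) y z)
    reassoc : ∀ a b c e → a * (b * (c * e)) ≡ c * a * b * e
    reassoc = solve-∀

  -- |𝓑(A)| = ∑ over y of (number of x ∈ A above y) · (number of z ∉ A above y)
  cardB≡ : + cardB (suc d) A? ≡ (+ n - + d) * (+ suc d * + card A?) - ‖ down 𝟙A ‖²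
  cardB≡ = begin
    + cardB (suc d) A?
      ≡⟨ length-filter (inB? (suc d) A?) (allTriples n) ⟩
    sumℤ (map (indicator ∘ inB? (suc d) A?) (allTriples n))
      ≡⟨ sumℤ-allTriples n (indicator ∘ inB? (suc d) A?) ⟩
    ∑ (λ x → ∑ λ y → ∑ λ z → indicator (inB? (suc d) A? (x , y , z)))
      ≡⟨ ∑-cong (λ x → ∑-cong λ y → trans (∑-cong (indicator-inB x y))
                                        (∑-* (𝟙A x * cover x y) (λ z → cover z y * (1ℤ - 𝟙A z)))) ⟩
    ∑ (λ x → ∑ λ y → 𝟙A x * cover x y * non-A-above y)
      ≡⟨ ∑-comm (λ x y → 𝟙A x * cover x y * non-A-above y) ⟩
    ∑ (λ y → ∑ λ x → 𝟙A x * cover x y * non-A-above y)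
      ≡⟨ ∑-cong (λ y → trans (∑-cong λ x → rearrange (𝟙A x) (cover x y) (non-A-above y))
                             (∑-* (non-A-above y) (λ x → cover x y * 𝟙A x))) ⟩
    ∑ (λ y → non-A-above y * down 𝟙A y)
      ≡⟨ ∑-cong (λ y → trans (cong (_* down 𝟙A y) (non-A-above≡ y)) (distrib (+ n - + ∣ y ∣) (down 𝟙A y))) ⟩
    ∑ (λ y → (+ n - + ∣ y ∣) * down 𝟙A y - down 𝟙A y * down 𝟙A y)
      ≡⟨ ∑-- (λ y → (+ n - + ∣ y ∣) * down 𝟙A y) (λ y → down 𝟙A y * down 𝟙A y) ⟩
    ∑ (λ y → (+ n - + ∣ y ∣) * down 𝟙A y) - ‖ down 𝟙A ‖²
      ≡⟨ cong (_- ‖ down 𝟙A ‖²) (∑-onLevel-weight (down-onLevel 𝟙A-onLevel) (λ j → + n - + j)) ⟩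
    (+ n - + d) * ∑ (down 𝟙A) - ‖ down 𝟙A ‖²
      ≡⟨ cong (λ t → (+ n - + d) * t - ‖ down 𝟙A ‖²)
              (trans (∑-down 𝟙A-onLevel) (cong (+ suc d *_) (sym card≡∑𝟙A))) ⟩
    (+ n - + d) * (+ suc d * + card A?) - ‖ down 𝟙A ‖² ∎
    where
    open ≡-Reasoning
    non-A-above : Subset n → ℤ
    non-A-above y = ∑ λ z → cover z y * (1ℤ - 𝟙A z)
    non-A-above≡ : ∀ y → non-A-above y ≡ (+ n - + ∣ y ∣) - down 𝟙A y
    non-A-above≡ y = begin
      ∑ (λ z → cover z y * (1ℤ - 𝟙A z))          ≡⟨ ∑-cong (λ z → split (cover z y) (𝟙A z)) ⟩
      ∑ (λ z → cover z y - cover z y * 𝟙A z)      ≡⟨ ∑-- (λ z → cover z y) (λ z → cover z y * 𝟙A z) ⟩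
      ∑ (λ z → cover z y) - down 𝟙A y             ≡⟨ cong (_- down 𝟙A y) (∑-cover-above y) ⟩
      (+ n - + ∣ y ∣) - down 𝟙A y                 ∎
      where
      split : ∀ c a → c * (1ℤ - a) ≡ c - c * a
      split = solve-∀
    rearrange : ∀ a c t → a * c * t ≡ t * (c * a)
    rearrange = solve-∀
    distrib : ∀ w g → (w - g) * g ≡ w * g - g * g
    distrib = solve-∀

  down-bound-𝟙A : suc d ℕ.≤ n →
    + (n C suc d) * ‖ down 𝟙A ‖²
      ≤ + d * (+ n - + suc d) * + (n C suc d) * + card A? + + n * (+ card A? * + card A?)
  down-bound-𝟙A 1+d≤n =
    subst₂ (λ a b → + (n C suc d) * ‖ down 𝟙A ‖² ≤ + d * (+ n - + suc d) * + (n C suc d) * a + + n * (b * b))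
           (trans ‖𝟙A‖² (sym card≡∑𝟙A)) (sym card≡∑𝟙A)
           (down-bound 1+d≤n 𝟙A-onLevel)

[k+1]*[n+1]C[k+1]≡[n+1]*nCk : ∀ n k → + suc k * + (suc n C suc k) ≡ + suc n * + (n C k)
[k+1]*[n+1]C[k+1]≡[n+1]*nCk n k = begin
  + suc k * + (suc n C suc k)
    ≡⟨ cong (λ t → + suc k * + t) (nCk+nC[k+1]≡[n+1]C[k+1] n k) ⟨
  + suc k * + (n C k ℕ.+ n C suc k)
    ≡⟨ cong (+ suc k *_) (ℤ.pos-+ (n C k) (n C suc k)) ⟩
  + suc k * (+ (n C k) + + (n C suc k))
    ≡⟨ ℤ.*-distribˡ-+ (+ suc k) (+ (n C k)) (+ (n C suc k)) ⟩
  + suc k * + (n C k) + + suc k * + (n C suc k)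
    ≡⟨ cong (_+_ (+ suc k * + (n C k))) (level-size-ratio n k) ⟨
  + suc k * + (n C k) + (+ n - + k) * + (n C k)
    ≡⟨ collect (+ n) (+ k) (+ (n C k)) ⟩
  + suc n * + (n C k) ∎
  where
  open ≡-Reasoning
  collect : ∀ n k c → (1ℤ + k) * c + (n - k) * c ≡ (1ℤ + n) * c
  collect = solve-∀

-- With N = C(n, k+1), C′ = C(n-1, k) and B = (n - k)(k + 1)|A| - Q, the spectral
-- bound N Q ≤ k (n - k - 1) N |A| + n |A|² becomes the claimed inequality after
-- multiplying through by n.
final-arithmetic : ∀ (n k N C′ S Q B : ℤ) → 0ℤ < n → 0ℤ ≤ 1ℤ + k → (1ℤ + k) * N ≡ n * C′ →
  B ≡ (n - k) * ((1ℤ + k) * S) - Q → N * Q ≤ k * (n - (1ℤ + k)) * N * S + n * (S * S) →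
  n * S * C′ ≤ B * C′ + (1ℤ + k) * (S * S)
final-arithmetic n k N C′ S Q _ n>0 1+k≥0 ratio refl bound =
  ℤ.*-cancelˡ-≤-pos _ _ n {{positive n>0}} (begin
  n * (n * S * C′)
    ≡⟨ rearrange n S C′ ⟩
  n * S * (n * C′)
    ≡⟨ cong (n * S *_) ratio ⟨
  n * S * ((1ℤ + k) * N)
    ≡⟨ expand n k N S ⟩
  (1ℤ + k) * (N * ((n - k) * ((1ℤ + k) * S)) - (k * (n - (1ℤ + k)) * N * S + n * (S * S)))
    + (1ℤ + k) * n * (S * S)
    ≤⟨ ℤ.+-monoˡ-≤ ((1ℤ + k) * n * (S * S)) (ℤ.*-monoˡ-≤-nonNeg (1ℤ + k) {{nonNegative 1+k≥0}}
                    (ℤ.+-monoʳ-≤ (N * ((n - k) * ((1ℤ + k) * S))) (ℤ.neg-mono-≤ bound))) ⟩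
  (1ℤ + k) * (N * ((n - k) * ((1ℤ + k) * S)) - N * Q) + (1ℤ + k) * n * (S * S)
    ≡⟨ cong (_+ (1ℤ + k) * n * (S * S)) (regroup n k N S Q) ⟩
  (1ℤ + k) * N * ((n - k) * ((1ℤ + k) * S) - Q) + (1ℤ + k) * n * (S * S)
    ≡⟨ cong (λ t → t * ((n - k) * ((1ℤ + k) * S) - Q) + (1ℤ + k) * n * (S * S)) ratio ⟩
  n * C′ * ((n - k) * ((1ℤ + k) * S) - Q) + (1ℤ + k) * n * (S * S)
    ≡⟨ finish n k C′ S Q ⟩
  n * (((n - k) * ((1ℤ + k) * S) - Q) * C′ + (1ℤ + k) * (S * S)) ∎)
  where
  open ℤ.≤-Reasoning
  rearrange : ∀ n S C → n * (n * S * C) ≡ n * S * (n * C)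
  rearrange = solve-∀
  expand : ∀ n k N S → n * S * ((1ℤ + k) * N)
    ≡ (1ℤ + k) * (N * ((n - k) * ((1ℤ + k) * S)) - (k * (n - (1ℤ + k)) * N * S + n * (S * S)))
      + (1ℤ + k) * n * (S * S)
  expand = solve-∀
  regroup : ∀ n k N S Q → (1ℤ + k) * (N * ((n - k) * ((1ℤ + k) * S)) - N * Q)
                        ≡ (1ℤ + k) * N * ((n - k) * ((1ℤ + k) * S) - Q)
  regroup = solve-∀
  finish : ∀ n k C S Q → n * C * ((n - k) * ((1ℤ + k) * S) - Q) + (1ℤ + k) * n * (S * S)
                       ≡ n * (((n - k) * ((1ℤ + k) * S) - Q) * C + (1ℤ + k) * (S * S))
  finish = solve-∀

lemma2p14 : (n d : ℕ) → 1 ℕ.≤ d → d ℕ.≤ n →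
            (A : Pred (Subset n) 0ℓ) (A? : Decidable A) →
            (∀ x → A x → ∣ x ∣ ≡ d) →
            n ℕ.* card A? ℕ.* ((n ∸ 1) C (d ∸ 1))
              ℕ.≤ cardB d A? ℕ.* ((n ∸ 1) C (d ∸ 1)) ℕ.+ d ℕ.* (card A? ℕ.* card A?)
lemma2p14 (suc n) (suc d) _ (s≤s d≤n) A A? A⊆level =
  ℤ.drop‿+≤+ (subst₂ _≤_ (sym lhs) (sym rhs)
    (final-arithmetic (+ suc n) (+ d) (+ (suc n C suc d)) C′ S ‖ down 𝟙A ‖² (+ cardB (suc d) A?)
                      (+<+ (s≤s z≤n)) (+≤+ z≤n) ([k+1]*[n+1]C[k+1]≡[n+1]*nCk n d)
                      cardB≡ (down-bound-𝟙A (s≤s d≤n))))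
  where
  open LevelSet A? A⊆level
  C′ S : ℤ
  C′ = + (n C d)
  S  = + card A?
  lhs : + (suc n ℕ.* card A? ℕ.* (n C d)) ≡ + suc n * S * C′
  lhs = trans (ℤ.pos-* (suc n ℕ.* card A?) (n C d)) (cong (_* C′) (ℤ.pos-* (suc n) (card A?)))
  rhs : + (cardB (suc d) A? ℕ.* (n C d) ℕ.+ suc d ℕ.* (card A? ℕ.* card A?))
        ≡ + cardB (suc d) A? * C′ + + suc d * (S * S)
  rhs = trans (ℤ.pos-+ (cardB (suc d) A? ℕ.* (n C d)) (suc d ℕ.* (card A? ℕ.* card A?)))
              (cong₂ _+_ (ℤ.pos-* (cardB (suc d) A?) (n C d))
                         (trans (ℤ.pos-* (suc d) (card A? ℕ.* card A?))
                                (cong (+ suc d *_) (ℤ.pos-* (card A?) (card A?)))))
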